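{- Let $k,t,a_1,a_2,\dots,a_t$ be positive integers such that $t\geq 3$ is odd and $\frac{2k}{t-1}\leq a_1\leq a_2\leq\dots\leq a_t$. Then $\mathrm{rc}_k(K_{a_1,a_2,\dots,a_t})\leq 3$.
   Context: Given an edge coloring $c:E(G)\to[\ell]$, a path is rainbow if no two of its edges receive the same color. $(G,c)$ is rainbow $k$-connected if every pair of distinct vertices is joined by $k$ pairwise internally disjoint rainbow paths. The rainbow $k$-connection number $\mathrm{rc}_k(G)$ is the minimum $\ell$ such that some coloring $c:E(G)\to[\ell]$ makes $(G,c)$ rainbow $k$-connected. $K_{a_1,\dots,a_t}$ denotes the complete $t$-partite graph with parts of sizes $a_1,\dots,a_t$. -}

module Defs where

open import Data.Nat using (ℕ; zero; suc; _+_; _*_; _∸_; _≤_)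
open import Data.Fin using (Fin)
open import Data.Product using (Σ; _×_; _,_; proj₁; proj₂)
open import Data.List using (List; []; _∷_; _++_)
open import Data.Unit using (⊤)
open import Relation.Nullary using (¬_)
open import Relation.Binary.PropositionalEquality using (_≡_; _≢_)
open import Data.List.Relation.Unary.Unique.Propositional using (Unique)
open import Data.List.Relation.Binary.Disjoint.Propositional using (Disjoint)

-- Vertex set of the complete t-partite graph K_{a_0,...,a_{t-1}}:
-- a vertex is a pair (part index i, position j within part i).
Vertex : (t : ℕ) → (Fin t → ℕ) → Set
Vertex t a = Σ (Fin t) (λ i → Fin (a i))

Adj : {t : ℕ} {a : Fin t → ℕ} → Vertex t a → Vertex t a → Set
Adj u v = proj₁ u ≢ proj₁ v

-- An edge colouring with colours in Fin ℓ, given as a symmetric function on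
-- ordered pairs of vertices (only its values on edges are relevant).
record EdgeColouring (t : ℕ) (a : Fin t → ℕ) (ℓ : ℕ) : Set where
  field
    col : Vertex t a → Vertex t a → Fin ℓ
    sym : ∀ u v → col u v ≡ col v u
open EdgeColouring public

Chain : {t : ℕ} {a : Fin t → ℕ} → List (Vertex t a) → Set
Chain []           = ⊤
Chain (x ∷ [])     = ⊤
Chain (x ∷ y ∷ xs) = Adj x y × Chain (y ∷ xs)

edgeColours : {t ℓ : ℕ} {a : Fin t → ℕ} → EdgeColouring t a ℓ →
              List (Vertex t a) → List (Fin ℓ)
edgeColours c []           = []
edgeColours c (x ∷ [])     = []
edgeColours c (x ∷ y ∷ xs) = col c x y ∷ edgeColours c (y ∷ xs)

pathVertices : {t : ℕ} {a : Fin t → ℕ} → Vertex t a → List (Vertex t a) →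
               Vertex t a → List (Vertex t a)
pathVertices u ins v = u ∷ (ins ++ (v ∷ []))

-- `ins` (internal vertices, in order) describes a u–v path:
-- all vertices distinct and consecutive vertices adjacent.
IsPath : {t : ℕ} {a : Fin t → ℕ} → Vertex t a → Vertex t a → List (Vertex t a) → Set
IsPath u v ins = Unique (pathVertices u ins v) × Chain (pathVertices u ins v)

IsRainbow : {t ℓ : ℕ} {a : Fin t → ℕ} → EdgeColouring t a ℓ →
            Vertex t a → Vertex t a → List (Vertex t a) → Set
IsRainbow c u v ins = Unique (edgeColours c (pathVertices u ins v))

RainbowKConnected : {t ℓ : ℕ} {a : Fin t → ℕ} → ℕ → EdgeColouring t a ℓ → Set
RainbowKConnected {t} {ℓ} {a} k c =
  (u v : Vertex t a) → u ≢ v →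
  Σ (Fin k → List (Vertex t a)) λ P →
    ((i : Fin k) → IsPath u v (P i) × IsRainbow c u v (P i)) ×
    ((i j : Fin k) → i ≢ j → (P i ≢ P j) × Disjoint (P i) (P j))

RcLe : (t : ℕ) (a : Fin t → ℕ) (k ℓ : ℕ) → Set
RcLe t a k ℓ = Σ (EdgeColouring t a ℓ) λ c → RainbowKConnected k c

-- Write t = 2m + 1 and view the parts as a centre C together with m pairs
-- (Lᵣ, Rᵣ). Colour an edge by the parts of its ends only: 0 between Lᵣ and
-- Rᵣ; 1 between C and an L, between two L's and between two R's; 2 between
-- C and an R and between Lᵣ and R_s for r ≠ s. Then every part X is the apex
-- of m rainbow triangles X p q whose corner pairs {p, q} are pairwise
-- disjoint. A vertex u ∈ X reaches any v through the triangle X p q by one of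
-- u p v, u q v, u q p v, which is rainbow because the triangle is; running
-- this through the s-th vertex of p and q for every triangle and every
-- s < a₁ gives m·a₁ ≥ k internally disjoint rainbow paths.
module Submission where

open import Defs hiding (sym)
open import Data.Nat using (ℕ; suc; _+_; _*_; _∸_; _≤_; _%_; _/_; z≤n)
open import Data.Nat.Properties using (*-comm; +-identityʳ; *-distribʳ-+; *-cancelˡ-≤)
open import Data.Nat.DivMod using (m≡m%n+[m/n]*n)
open import Data.Fin as Fin using (Fin; toℕ; inject≤; _↑ˡ_; _↑ʳ_; splitAt)
open import Data.Fin.Patterns using (0F; 1F; 2F)
open import Data.Fin.Properties
  using (_≟_; toℕ-injective; toℕ-inject≤; inject≤-injective; splitAt-↑ˡ; splitAt-↑ʳ; *↔×)
open import Data.Bool using (if_then_else_)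
open import Data.Sum using (_⊎_; inj₁; inj₂; [_,_]′)
open import Data.Product using (∃; _×_; _,_; proj₁; proj₂)
open import Data.List using (List; []; _∷_)
open import Data.List.Relation.Unary.All using (All; []; _∷_; lookup)
open import Data.List.Relation.Unary.AllPairs using ([]; _∷_)
open import Data.List.Relation.Unary.Any using (here)
open import Data.List.Membership.Propositional using (_∈_)
open import Data.List.Relation.Binary.Disjoint.Propositional using (Disjoint)
open import Data.Unit using (tt)
open import Data.Empty using (⊥-elim)
open import Function using (_∘_; _↣_; Injection)
open import Function.Construct.Composition using (_↣-∘_)
open import Function.Properties.Inverse using (↔⇒↣)
open import Function.Bundles using (mk↣)
open import Relation.Nullary using (yes; no; does)
open import Relation.Binary.PropositionalEquality
  using (_≡_; _≢_; refl; sym; trans; cong; cong₂; subst; module ≡-Reasoning)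

Distinct₃ : {A : Set} → A → A → A → Set
Distinct₃ x y z = x ≢ y × y ≢ z × x ≢ z

Distinct₃-cong : {A : Set} {x x′ y y′ z z′ : A} →
                 x ≡ x′ → y ≡ y′ → z ≡ z′ → Distinct₃ x′ y′ z′ → Distinct₃ x y z
Distinct₃-cong refl refl refl d = d

record RainbowTriangle {P : Set} {ℓ : ℕ} (f : P → P → Fin ℓ) (x : P) : Set where
  constructor mkRainbowTriangle
  field
    p q     : P
    x≢p     : x ≢ p
    x≢q     : x ≢ q
    p≢q     : p ≢ q
    rainbow : Distinct₃ (f x p) (f p q) (f q x)

-- The labels make the corner pairs {p, q} of distinct triangles disjoint.
record RainbowFan {P : Set} {ℓ : ℕ} (f : P → P → Fin ℓ) (m : ℕ) (x : P) : Set where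
  field
    triangle : Fin m → RainbowTriangle f x
    label    : P → ℕ
    labelled : ∀ r → label (RainbowTriangle.p (triangle r)) ≡ toℕ r ×
                     label (RainbowTriangle.q (triangle r)) ≡ toℕ r

module _ {P Q : Set} {ℓ : ℕ} {f : P → P → Fin ℓ}
         (enc : P → Q) (dec : Q → P) (dec-enc : ∀ y → dec (enc y) ≡ y) where

  private
    enc-≢ : ∀ {x y} → dec x ≢ y → x ≢ enc y
    enc-≢ {y = y} dx≢y x≡ey = dx≢y (trans (cong dec x≡ey) (dec-enc y))

  triangle-pullback : ∀ {x} → RainbowTriangle f (dec x) →
                      RainbowTriangle (λ i j → f (dec i) (dec j)) x
  triangle-pullback {x} (mkRainbowTriangle p q x≢p x≢q p≢q rainbow) =
    mkRainbowTriangle (enc p) (enc q) (enc-≢ x≢p) (enc-≢ x≢q)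
      (enc-≢ (p≢q ∘ trans (sym (dec-enc p))))
      (Distinct₃-cong (cong (f (dec x)) (dec-enc p)) (cong₂ f (dec-enc p) (dec-enc q))
                      (cong (λ y → f y (dec x)) (dec-enc q)) rainbow)

  fan-pullback : ∀ {m x} → RainbowFan f m (dec x) →
                 RainbowFan (λ i j → f (dec i) (dec j)) m x
  fan-pullback {m} F = record
    { triangle = triangle-pullback ∘ triangle
    ; label    = label ∘ dec
    ; labelled = λ r → trans (cong label (dec-enc (p r))) (proj₁ (labelled r))
                     , trans (cong label (dec-enc (q r))) (proj₂ (labelled r))
    }
    where
      open RainbowFan F
      p q : Fin m → P
      p = RainbowTriangle.p ∘ triangle
      q = RainbowTriangle.q ∘ triangle

module _ {t ℓ : ℕ} {a : Fin t → ℕ} (c : EdgeColouring t a ℓ) where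

  private
    adj⇒≢ : {u w : Vertex t a} → Adj u w → u ≢ w
    adj⇒≢ u≁w = u≁w ∘ cong proj₁

  rainbowPath₂ : ∀ {u w v} → u ≢ v → Adj u w → Adj w v →
                 col c u w ≢ col c w v →
                 IsPath u v (w ∷ []) × IsRainbow c u v (w ∷ [])
  rainbowPath₂ u≢v uw wv rainbow =
    ( ((adj⇒≢ uw ∷ u≢v ∷ []) ∷ (adj⇒≢ wv ∷ []) ∷ [] ∷ [])
    , uw , wv , tt )
    , (rainbow ∷ []) ∷ [] ∷ []

  rainbowPath₃ : ∀ {u w₁ w₂ v} → u ≢ v → Adj u w₁ → Adj u w₂ →
                 Adj w₁ w₂ → Adj w₁ v → Adj w₂ v →
                 Distinct₃ (col c u w₁) (col c w₁ w₂) (col c w₂ v) →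
                 IsPath u v (w₁ ∷ w₂ ∷ []) × IsRainbow c u v (w₁ ∷ w₂ ∷ [])
  rainbowPath₃ u≢v uw₁ uw₂ w₁w₂ w₁v w₂v (c₁≢c₂ , c₂≢c₃ , c₁≢c₃) =
    ( ((adj⇒≢ uw₁ ∷ adj⇒≢ uw₂ ∷ u≢v ∷ []) ∷ (adj⇒≢ w₁w₂ ∷ adj⇒≢ w₁v ∷ [])
        ∷ (adj⇒≢ w₂v ∷ []) ∷ [] ∷ [])
    , uw₁ , w₁w₂ , w₂v , tt )
    , (c₁≢c₂ ∷ c₁≢c₃ ∷ []) ∷ (c₂≢c₃ ∷ []) ∷ [] ∷ []

partColouring : {t ℓ : ℕ} {a : Fin t → ℕ} (f : Fin t → Fin t → Fin ℓ) →
                (∀ i j → f i j ≡ f j i) → EdgeColouring t a ℓ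
partColouring f f-sym = record
  { col = λ u v → f (proj₁ u) (proj₁ v)
  ; sym = λ u v → f-sym (proj₁ u) (proj₁ v) }

nonEmpty-disjoint⇒≢ : {A : Set} {xs ys : List A} → xs ≢ [] → Disjoint xs ys → xs ≢ ys
nonEmpty-disjoint⇒≢ {xs = []}    xs≢[] _    _    = xs≢[] refl
nonEmpty-disjoint⇒≢ {xs = _ ∷ _} _     disj refl = disj (here refl , here refl)

pairsInjection : ∀ {k} m n → k ≤ m * n → Fin k ↣ (Fin m × Fin n)
pairsInjection m n k≤mn =
  ↔⇒↣ (*↔× {m}) ↣-∘ mk↣ (λ {i} {j} → inject≤-injective k≤mn k≤mn i j)

module _ {t ℓ : ℕ} {a : Fin t → ℕ} {f : Fin t → Fin t → Fin ℓ}
         (f-sym : ∀ i j → f i j ≡ f j i) where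

  private
    c : EdgeColouring t a ℓ
    c = partColouring f f-sym

  record PathThrough (u v : Vertex t a) (T : RainbowTriangle f (proj₁ u))
                     (pick : (i : Fin t) → Fin (a i)) : Set where
    open RainbowTriangle T
    field
      inner       : List (Vertex t a)
      rainbowPath : IsPath u v inner × IsRainbow c u v inner
      nonEmpty    : inner ≢ []
      inner⊆      : All (λ w → w ≡ (p , pick p) ⊎ w ≡ (q , pick q)) inner

  pathThrough : ∀ u v → u ≢ v → (T : RainbowTriangle f (proj₁ u)) →
                (pick : (i : Fin t) → Fin (a i)) → PathThrough u v T pick
  pathThrough (i , _) (j , _) u≢v
              (mkRainbowTriangle p q i≢p i≢q p≢q (ip≢pq , pq≢qi , ip≢qi)) pick
    with j ≟ p
  ... | yes refl = record
    { inner       = (q , pick q) ∷ []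
    ; rainbowPath = rainbowPath₂ c u≢v i≢q (p≢q ∘ sym)
                      (λ iq≡qp → pq≢qi (trans (f-sym p q) (trans (sym iq≡qp) (f-sym i q))))
    ; nonEmpty    = λ ()
    ; inner⊆      = inj₂ refl ∷ [] }
  ... | no j≢p with f p j ≟ f i p
  ...   | no pj≢ip = record
    { inner       = (p , pick p) ∷ []
    ; rainbowPath = rainbowPath₂ c u≢v i≢p (j≢p ∘ sym) (pj≢ip ∘ sym)
    ; nonEmpty    = λ ()
    ; inner⊆      = inj₁ refl ∷ [] }
  -- Here u q p v repeats the colours of the triangle, since f p j = f i p.
  ...   | yes pj≡ip = record
    { inner       = (q , pick q) ∷ (p , pick p) ∷ []
    ; rainbowPath = rainbowPath₃ c u≢v i≢q i≢p (p≢q ∘ sym) q≢j (j≢p ∘ sym)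
                      (Distinct₃-cong (f-sym i q) (f-sym q p) pj≡ip
                        ((pq≢qi ∘ sym) , (ip≢pq ∘ sym) , (ip≢qi ∘ sym)))
    ; nonEmpty    = λ ()
    ; inner⊆      = inj₂ refl ∷ inj₁ refl ∷ [] }
    where
      q≢j : q ≢ j
      q≢j refl = ip≢pq (sym pj≡ip)

  fans⇒rainbowConnected : ∀ {k m n} → (∀ i → n ≤ a i) → k ≤ m * n →
                          ((x : Fin t) → RainbowFan f m x) → RainbowKConnected k c
  fans⇒rainbowConnected {k} {m} {n} n≤a k≤mn fan u v u≢v =
    inner ∘ path , rainbowPath ∘ path , separated
    where
      open PathThrough
      open Injection (pairsInjection m n k≤mn) using (injective) renaming (to to index)
      open RainbowFan (fan (proj₁ u))

      r : Fin k → Fin m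
      r = proj₁ ∘ index

      s : Fin k → Fin n
      s = proj₂ ∘ index

      pick : Fin n → (i : Fin t) → Fin (a i)
      pick s′ i = inject≤ s′ (n≤a i)

      path : (z : Fin k) → PathThrough u v (triangle (r z)) (pick (s z))
      path z = pathThrough u v u≢v (triangle (r z)) (pick (s z))

      address : ∀ z {w} → w ∈ inner (path z) →
                label (proj₁ w) ≡ toℕ (r z) × toℕ (proj₂ w) ≡ toℕ (s z)
      address z w∈ with lookup (inner⊆ (path z)) w∈
      ... | inj₁ refl = proj₁ (labelled (r z)) , toℕ-inject≤ (s z) _
      ... | inj₂ refl = proj₂ (labelled (r z)) , toℕ-inject≤ (s z) _

      disjoint : ∀ z z′ → z ≢ z′ → Disjoint (inner (path z)) (inner (path z′))
      disjoint z z′ z≢z′ (w∈ , w∈′) with address z w∈ | address z′ w∈′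
      ... | r≡ , s≡ | r≡′ , s≡′ = z≢z′ (injective (cong₂ _,_
            (toℕ-injective (trans (sym r≡) r≡′)) (toℕ-injective (trans (sym s≡) s≡′))))

      separated : ∀ z z′ → z ≢ z′ →
                  (inner (path z) ≢ inner (path z′)) × Disjoint (inner (path z)) (inner (path z′))
      separated z z′ z≢z′ =
        nonEmpty-disjoint⇒≢ (nonEmpty (path z)) (disjoint z z′ z≢z′) , disjoint z z′ z≢z′

data Part (m : ℕ) : Set where
  centre     : Part m
  left right : Fin m → Part m

module PairedParts (m : ℕ) where

  toFin : Part m → Fin (suc (m + m))
  toFin centre    = 0F
  toFin (left r)  = Fin.suc (r ↑ˡ m)
  toFin (right r) = Fin.suc (m ↑ʳ r)

  fromFin : Fin (suc (m + m)) → Part m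
  fromFin 0F          = centre
  fromFin (Fin.suc i) = [ left , right ]′ (splitAt m i)

  fromFin-toFin : ∀ x → fromFin (toFin x) ≡ x
  fromFin-toFin centre    = refl
  fromFin-toFin (left r)  rewrite splitAt-↑ˡ m r m = refl
  fromFin-toFin (right r) rewrite splitAt-↑ʳ m m r = refl

  pairColour : Fin m → Fin m → Fin 3
  pairColour r s = if does (r ≟ s) then 0F else 2F

  pairColour-refl : ∀ r → pairColour r r ≡ 0F
  pairColour-refl r with r ≟ r
  ... | yes _   = refl
  ... | no r≢r = ⊥-elim (r≢r refl)

  pairColour-≢ : ∀ {r s} → r ≢ s → pairColour r s ≡ 2F
  pairColour-≢ {r} {s} r≢s with r ≟ s
  ... | yes r≡s = ⊥-elim (r≢s r≡s)
  ... | no _    = refl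

  pairColour-sym : ∀ r s → pairColour r s ≡ pairColour s r
  pairColour-sym r s with r ≟ s | s ≟ r
  ... | yes _   | yes _   = refl
  ... | yes r≡s | no s≢r = ⊥-elim (s≢r (sym r≡s))
  ... | no r≢s | yes s≡r = ⊥-elim (r≢s (sym s≡r))
  ... | no _    | no _    = refl

  -- The value on centre–centre is never read: no edge joins a part to itself.
  colour : Part m → Part m → Fin 3
  colour centre    centre    = 0F
  colour centre    (left _)  = 1F
  colour centre    (right _) = 2F
  colour (left _)  centre    = 1F
  colour (right _) centre    = 2F
  colour (left _)  (left _)  = 1F
  colour (right _) (right _) = 1F
  colour (left r)  (right s) = pairColour r s
  colour (right r) (left s)  = pairColour r s

  colour-sym : ∀ x y → colour x y ≡ colour y x
  colour-sym centre    centre    = refl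
  colour-sym centre    (left _)  = refl
  colour-sym centre    (right _) = refl
  colour-sym (left _)  centre    = refl
  colour-sym (right _) centre    = refl
  colour-sym (left _)  (left _)  = refl
  colour-sym (right _) (right _) = refl
  colour-sym (left r)  (right s) = pairColour-sym r s
  colour-sym (right r) (left s)  = pairColour-sym r s

  private
    left-injective : ∀ {r s} → left {m} r ≡ left s → r ≡ s
    left-injective refl = refl

    right-injective : ∀ {r s} → right {m} r ≡ right s → r ≡ s
    right-injective refl = refl

  triangleAt : (x : Part m) → Fin m → RainbowTriangle colour x
  triangleAt centre r =
    mkRainbowTriangle (left r) (right r) (λ ()) (λ ()) (λ ())
      (Distinct₃-cong refl (pairColour-refl r) refl ((λ ()) , (λ ()) , (λ ())))
  triangleAt (left r₀) r with r ≟ r₀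
  ... | yes refl =
    mkRainbowTriangle centre (right r) (λ ()) (λ ()) (λ ())
      (Distinct₃-cong refl refl (pairColour-refl r) ((λ ()) , (λ ()) , (λ ())))
  ... | no r≢r₀ =
    mkRainbowTriangle (left r) (right r) (r≢r₀ ∘ sym ∘ left-injective) (λ ()) (λ ())
      (Distinct₃-cong refl (pairColour-refl r) (pairColour-≢ r≢r₀) ((λ ()) , (λ ()) , (λ ())))
  triangleAt (right r₀) r with r ≟ r₀
  ... | yes refl =
    mkRainbowTriangle centre (left r) (λ ()) (λ ()) (λ ())
      (Distinct₃-cong refl refl (pairColour-refl r) ((λ ()) , (λ ()) , (λ ())))
  ... | no r≢r₀ =
    mkRainbowTriangle (left r) (right r) (λ ()) (r≢r₀ ∘ sym ∘ right-injective) (λ ())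
      (Distinct₃-cong (pairColour-≢ (r≢r₀ ∘ sym)) (pairColour-refl r) refl
        ((λ ()) , (λ ()) , (λ ())))

  -- label x y is the index of the triangle at x with corner y; the centre is a
  -- corner only at left r₀ and right r₀, of the triangle with index r₀.
  label : Part m → Part m → ℕ
  label centre     centre    = 0
  label (left r₀)  centre    = toℕ r₀
  label (right r₀) centre    = toℕ r₀
  label _          (left r)  = toℕ r
  label _          (right r) = toℕ r

  triangleAt-labelled : ∀ x r → label x (RainbowTriangle.p (triangleAt x r)) ≡ toℕ r ×
                                label x (RainbowTriangle.q (triangleAt x r)) ≡ toℕ r
  triangleAt-labelled centre r = refl , refl
  triangleAt-labelled (left r₀) r with r ≟ r₀
  ... | yes refl = refl , refl
  ... | no _     = refl , refl
  triangleAt-labelled (right r₀) r with r ≟ r₀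
  ... | yes refl = refl , refl
  ... | no _     = refl , refl

  fanAt : (x : Part m) → RainbowFan colour m x
  fanAt x = record
    { triangle = triangleAt x ; label = label x ; labelled = triangleAt-labelled x }

odd⇒suc-double : ∀ n → n % 2 ≡ 1 → ∃ λ h → n ≡ suc (h + h)
odd⇒suc-double n n%2≡1 = n / 2 , (begin
  n                      ≡⟨ m≡m%n+[m/n]*n n 2 ⟩
  n % 2 + n / 2 * 2      ≡⟨ cong₂ _+_ n%2≡1 (*-comm (n / 2) 2) ⟩
  suc (2 * (n / 2))      ≡⟨ cong (λ h → suc (n / 2 + h)) (+-identityʳ (n / 2)) ⟩
  suc (n / 2 + n / 2)    ∎)
  where open ≡-Reasoning

halve-≤ : ∀ k m n → 2 * k ≤ (m + m) * n → k ≤ m * n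
halve-≤ k m n 2k≤ = *-cancelˡ-≤ 2 (subst (2 * k ≤_) double 2k≤)
  where
    double : (m + m) * n ≡ 2 * (m * n)
    double = trans (*-distribʳ-+ n m m) (cong (m * n +_) (sym (+-identityʳ (m * n))))

mainTheorem3 : (k t : ℕ) (a : Fin t → ℕ) →
    1 ≤ k → 3 ≤ t → t % 2 ≡ 1 →
    ((i : Fin t) → 1 ≤ a i) →
    ((i j : Fin t) → toℕ i ≤ toℕ j → a i ≤ a j) →
    ((i₀ : Fin t) → toℕ i₀ ≡ 0 → 2 * k ≤ (t ∸ 1) * a i₀) →
    RcLe t a k 3
mainTheorem3 k t a _ _ t-odd _ a-mono 2k≤ with odd⇒suc-double t t-odd
... | m , refl =
  partColouring f f-sym ,
  fans⇒rainbowConnected f-sym (λ i → a-mono 0F i z≤n) (halve-≤ k m (a 0F) (2k≤ 0F refl))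
    (λ x → fan-pullback toFin fromFin fromFin-toFin (fanAt (fromFin x)))
  where
    open PairedParts m
    f : Fin t → Fin t → Fin 3
    f i j = colour (fromFin i) (fromFin j)
    f-sym : ∀ i j → f i j ≡ f j i
    f-sym i j = colour-sym (fromFin i) (fromFin j)
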